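{- Let $\mathcal X=(\Omega,S)$ be a coherent configuration such that every one-point extension $\mathcal X_\alpha$, $\alpha\in\Omega$, is separable. Then $\mathcal X$ is sesquiseparable.
   Context: A coherent configuration $\mathcal X=(\Omega,S)$ ($\Omega$ finite) is a partition $S$ of $\Omega^2$ with $1_\Omega$ a union of elements of $S$, $S$ closed under transposition, and intersection numbers $c_{rs}^t=|\alpha r\cap\beta s^*|$ independent of $(\alpha,\beta)\in t$. Basis relations: elements of $S$; relations: unions; fibers: $\Delta$ with $1_\Delta\in S$, $F(\mathcal X)$ their set. An isomorphism $\mathcal X\to\mathcal X'$ is a bijection $f$ of point sets with $s^f\in S'$ for all $s\in S$. An algebraic isomorphism is a bijection $\varphi:S\to S'$ preserving intersection numbers (extended to relations by unions; $\Delta^\varphi$ defined by $\varphi(1_\Delta)=1_{\Delta^\varphi}$); $\mathrm{Iso}(\mathcal X,\mathcal X',\varphi)$ is the set of isomorphisms $f$ with $s^f=\varphi(s)$ for all $s\in S$. $\mathcal X$ is separable if $\mathrm{Iso}(\mathcal X,\mathcal X',\varphi)\ne\emptyset$ for every algebraic isomorphism $\varphi$ from $\mathcal X$ to any coherent configuration $\mathcal X'$. The one-point extension $\mathcal X_\alpha$ is the smallest coherent configuration whose relations include all relations of $\mathcal X$ and with $\{(\alpha,\alpha)\}$ a basis relation. An $(\alpha,\alpha')$-extension of $\varphi$ is an algebraic isomorphism $\mathcal X_\alpha\to\mathcal X'_{\alpha'}$ agreeing with $\varphi$ on $S$ and mapping $1_{\{\alpha\}}$ to $1_{\{\alpha'\}}$.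 $\varphi$ is sesquiclosed if it has an $(\alpha,\alpha')$-extension whenever $\alpha\in\Delta\in F(\mathcal X)$, $\alpha'\in\Delta'\in F(\mathcal X')$, $\Delta^\varphi=\Delta'$. $\mathcal X$ is sesquiseparable if $\mathrm{Iso}(\mathcal X,\mathcal X',\varphi)\ne\emptyset$ for every sesquiclosed algebraic isomorphism $\varphi$ from $\mathcal X$. -}

module Defs where

open import Data.Nat using (ℕ; zero; suc; _+_)
open import Data.Bool using (Bool; if_then_else_)
open import Data.Fin using (Fin; zero; suc; _≟_)
open import Data.Product using (Σ; ∃; ∃-syntax; _×_; _,_; proj₁; proj₂)
open import Relation.Nullary.Decidable using (⌊_⌋; _×-dec_)
open import Relation.Binary.PropositionalEquality using (_≡_)
open import Function.Bundles using (_↔_; Inverse)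

countFin : ∀ {n} → (Fin n → Bool) → ℕ
countFin {zero}  f = 0
countFin {suc n} f = (if f zero then 1 else 0) + countFin (λ i → f (suc i))

-- Given a colouring col of Ω² (Ω = Fin n) with colours Fin m (colour = basis relation),
-- cnt col α β r s = | α r ∩ β s* | = #{ γ : (α,γ) ∈ r and (β,γ) ∈ s* }
-- where (β,γ) ∈ s* iff (γ,β) ∈ s.
cnt : ∀ {n m} → (Fin n → Fin n → Fin m) → Fin n → Fin n → Fin m → Fin m → ℕ
cnt col α β r s = countFin (λ γ → ⌊ (col α γ ≟ r) ×-dec (col γ β ≟ s) ⌋)

-- A coherent configuration on the point set Ω = Fin n.
-- The partition S of Ω² is given by a surjective colouring col : Ω² → Fin m;
-- the basis relations are the (nonempty) colour classes.
record CC (n : ℕ) : Set where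
  field
    m      : ℕ
    col    : Fin n → Fin n → Fin m
    surj   : ∀ (r : Fin m) → ∃[ α ] ∃[ β ] col α β ≡ r
    -- 1_Ω is a union of basis relations: a class meeting the diagonal lies inside it
    diag   : ∀ α β γ → col α α ≡ col β γ → β ≡ γ
    transp : ∀ α β γ δ → col α β ≡ col γ δ → col β α ≡ col δ γ
    regular : ∀ (r s : Fin m) α β α' β' → col α β ≡ col α' β' →
              cnt col α β r s ≡ cnt col α' β' r s

open CC public

isect : ∀ {n} (X : CC n) → Fin (m X) → Fin (m X) → Fin (m X) → ℕ
isect X r s t = cnt (col X) (proj₁ (surj X t)) (proj₁ (proj₂ (surj X t))) r s

record AlgIso {n n'} (X : CC n) (X' : CC n') : Set where
  field
    bij      : Fin (m X) ↔ Fin (m X')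
  φ : Fin (m X) → Fin (m X')
  φ = Inverse.to bij
  field
    preserve : ∀ r s t → isect X r s t ≡ isect X' (φ r) (φ s) (φ t)

open AlgIso public using (bij; preserve)

apply : ∀ {n n'} {X : CC n} {X' : CC n'} → AlgIso X X' → Fin (m X) → Fin (m X')
apply ψ = AlgIso.φ ψ

Iso : ∀ {n n'} (X : CC n) (X' : CC n') → AlgIso X X' → Set
Iso {n} {n'} X X' φ =
  Σ (Fin n ↔ Fin n') λ f →
    ∀ α β → col X' (Inverse.to f α) (Inverse.to f β) ≡ apply φ (col X α β)

Separable : ∀ {n} → CC n → Set
Separable X = ∀ n' (X' : CC n') (φ : AlgIso X X') → Iso X X' φ

Refines : ∀ {n} → CC n → CC n → Set
Refines Y X = ∀ α β γ δ → col Y α β ≡ col Y γ δ → col X α β ≡ col X γ δ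

PointBasis : ∀ {n} → CC n → Fin n → Set
PointBasis Y α = ∀ β γ → col Y β γ ≡ col Y α α → (β ≡ α) × (γ ≡ α)

IsOnePointExt : ∀ {n} → CC n → Fin n → CC n → Set
IsOnePointExt {n} X α Y =
  Refines Y X × PointBasis Y α ×
  (∀ (Z : CC n) → Refines Z X → PointBasis Z α → Refines Z Y)

-- ψ : Y → Y' (Y = X_α, Y' = X'_{α'}) is an (α,α')-extension of φ:
-- it agrees with φ on S (ψ(y) ⊆ φ(s) for each basis relation y ⊆ s; equivalently
-- ψ(s) = φ(s) for every s ∈ S) and maps 1_{α} to 1_{α'}.
IsExtension : ∀ {n n'} {X : CC n} {X' : CC n'} → AlgIso X X' →
              Fin n → Fin n' → (Y : CC n) (Y' : CC n') → AlgIso Y Y' → Set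
IsExtension {X = X} {X'} φ α α' Y Y' ψ =
  (∀ β γ β' γ' → apply ψ (col Y β γ) ≡ col Y' β' γ' →
                 apply φ (col X β γ) ≡ col X' β' γ') ×
  (apply ψ (col Y α α) ≡ col Y' α' α')

-- φ is sesquiclosed: whenever α ∈ Δ, α' ∈ Δ' with Δ^φ = Δ' (i.e. φ(1_Δ) = 1_{Δ'},
-- where 1_Δ is the basis relation containing (α,α)), φ has an (α,α')-extension.
Sesquiclosed : ∀ {n n'} {X : CC n} {X' : CC n'} → AlgIso X X' → Set
Sesquiclosed {n} {n'} {X} {X'} φ =
  ∀ (α : Fin n) (α' : Fin n') → apply φ (col X α α) ≡ col X' α' α' →
  ∀ (Y : CC n) → IsOnePointExt X α Y → ∀ (Y' : CC n') → IsOnePointExt X' α' Y' →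
  Σ (AlgIso Y Y') λ ψ → IsExtension φ α α' Y Y' ψ

Sesquiseparable : ∀ {n} → CC n → Set
Sesquiseparable {n} X =
  ∀ n' (X' : CC n') (φ : AlgIso X X') → Sesquiclosed φ → Iso X X' φ

module Submission where

-- Let φ : X → X′ be a sesquiclosed algebraic isomorphism and α a point of X. The basis
-- relation 1_{α} of X is characterised by intersection numbers (c_{tu}^t = 0 for u ≠ t), so
-- φ maps it to some 1_{α′}. Both one-point extensions X_α and X′_{α′} exist: each is the
-- coherent closure (stable Weisfeiler–Leman refinement) of the colouring of X with α marked.
-- Sesquiclosedness gives an algebraic isomorphism ψ : X_α → X′_{α′} extending φ, separability
-- of X_α realises ψ by a bijection f, and since ψ extends φ, f is an isomorphism inducing φ.

open import Defs
open import Data.Bool using (Bool; true; false; if_then_else_; T)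
import Data.Bool as Bool
open import Data.Fin using (Fin; zero; suc; _≟_; combine; remQuot)
open import Data.Fin.Properties
  using (¬Fin0; any?; all?; suc-injective; remQuot-combine; combine-remQuot)
open import Data.Nat using (ℕ; zero; suc; _+_; _*_; _≤_; _<_; z≤n; s≤s)
import Data.Nat as ℕ
open import Data.Nat.Properties
  using (+-*-semiring; +-identityʳ; *-identityˡ; *-assoc; +-mono-≤; +-mono-<-≤; +-mono-≤-<;
         ≤-refl; ≤-pred; <-≤-trans; m≤n+m; n≤0⇒n≡0; ≮⇒≥; n>0⇒n≢0)
open import Data.Product using (∃; _×_; _,_; proj₁; proj₂; uncurry; swap)
open import Data.Product.Function.NonDependent.Propositional using (_×-⇔_)
open import Data.Product.Properties using (≡-dec)
open import Data.Sum using (_⊎_; inj₁; inj₂)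
open import Function using (_∘_; _on_; _⇔_; mk⇔)
open import Function.Bundles using (Inverse)
open import Function.Properties.Inverse using (↔-refl)
open import Level using (0ℓ)
open import Relation.Binary using (Rel; IsDecEquivalence; DecidableEquality)
import Relation.Binary.Construct.On as On
open import Relation.Binary.PropositionalEquality
open import Relation.Nullary using (Dec; does; yes; no; ¬_; contradiction)
open import Relation.Nullary.Decidable
  using (⌊_⌋; _×-dec_; ¬?; map′; decidable-stable; isYes≗does; does-⇔; toWitness; fromWitness)
open import Algebra.Properties.Semiring.Sum +-*-semiring
  using (sum; sum-syntax; ∑-comm; sum-cong-≗; sum-replicate-zero; *-distribˡ-sum; *-distribʳ-sum)

-- Counting over Fin n

-- Defined through `does`, which computes through `_×-dec_` and `map′`; `⌊_⌋` (used by
-- `countFin` and `cnt`) does not, hence the bridge `countFin-∑`.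
𝟙 : ∀ {a} {A : Set a} → Dec A → ℕ
𝟙 a? = if does a? then 1 else 0

𝟙-× : ∀ {a b} {A : Set a} {B : Set b} (a? : Dec A) (b? : Dec B) → 𝟙 (a? ×-dec b?) ≡ 𝟙 a? * 𝟙 b?
𝟙-× a? b? with does a?
... | true  = sym (+-identityʳ (𝟙 b?))
... | false = refl

𝟙-mono : ∀ {a b} {A : Set a} {B : Set b} → (A → B) → (a? : Dec A) (b? : Dec B) → 𝟙 a? ≤ 𝟙 b?
𝟙-mono A→B (no _)  _       = z≤n
𝟙-mono A→B (yes _) (yes _) = s≤s z≤n
𝟙-mono A→B (yes a) (no ¬b) = contradiction (A→B a) ¬b

𝟙-mono-< : ∀ {a b} {A : Set a} {B : Set b} → ¬ A → B → (a? : Dec A) (b? : Dec B) → 𝟙 a? < 𝟙 b?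
𝟙-mono-< ¬a b (no _)  (yes _) = s≤s z≤n
𝟙-mono-< ¬a b (yes a) _       = contradiction a ¬a
𝟙-mono-< ¬a b _       (no ¬b) = contradiction b ¬b

⌊⌋-⇔ : ∀ {a b} {A : Set a} {B : Set b} → A ⇔ B → (a? : Dec A) (b? : Dec B) → ⌊ a? ⌋ ≡ ⌊ b? ⌋
⌊⌋-⇔ A⇔B a? b? = trans (isYes≗does a?) (trans (does-⇔ A⇔B a? b?) (sym (isYes≗does b?)))

∑-mono-≤ : ∀ {n} {f g : Fin n → ℕ} → (∀ i → f i ≤ g i) → sum f ≤ sum g
∑-mono-≤ {zero}  f≤g = z≤n
∑-mono-≤ {suc n} f≤g = +-mono-≤ (f≤g zero) (∑-mono-≤ (f≤g ∘ suc))

∑-mono-< : ∀ {n} {f g : Fin n → ℕ} → (∀ i → f i ≤ g i) → ∀ j → f j < g j → sum f < sum g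
∑-mono-< {suc n} f≤g zero    fj<gj = +-mono-<-≤ fj<gj (∑-mono-≤ (f≤g ∘ suc))
∑-mono-< {suc n} f≤g (suc j) fj<gj = +-mono-≤-< (f≤g zero) (∑-mono-< (f≤g ∘ suc) j fj<gj)

∑-δ : ∀ {m} (x : Fin m) (w : Fin m → ℕ) → ∑[ z < m ] (𝟙 (x ≟ z) * w z) ≡ w x
∑-δ {suc m} zero    w = trans (cong₂ _+_ (*-identityˡ (w zero)) (sum-replicate-zero m)) (+-identityʳ (w zero))
∑-δ {suc m} (suc x) w = ∑-δ {m} x (w ∘ suc)

∑∑-δ : ∀ {m} (x y : Fin m) (F : Fin m → Fin m → ℕ) →
       ∑[ z < m ] ∑[ z′ < m ] (𝟙 ((x ≟ z) ×-dec (y ≟ z′)) * F z z′) ≡ F x y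
∑∑-δ {m} x y F = begin
  ∑[ z < m ] ∑[ z′ < m ] (𝟙 ((x ≟ z) ×-dec (y ≟ z′)) * F z z′)
    ≡⟨ sum-cong-≗ (λ z → sum-cong-≗ λ z′ →
         trans (cong (_* F z z′) (𝟙-× (x ≟ z) (y ≟ z′))) (*-assoc (𝟙 (x ≟ z)) _ _)) ⟩
  ∑[ z < m ] ∑[ z′ < m ] (𝟙 (x ≟ z) * (𝟙 (y ≟ z′) * F z z′))
    ≡⟨ sum-cong-≗ (λ z → sym (*-distribˡ-sum (𝟙 (x ≟ z)) (λ z′ → 𝟙 (y ≟ z′) * F z z′))) ⟩
  ∑[ z < m ] (𝟙 (x ≟ z) * ∑[ z′ < m ] (𝟙 (y ≟ z′) * F z z′))
    ≡⟨ sum-cong-≗ (λ z → cong (𝟙 (x ≟ z) *_) (∑-δ y (F z))) ⟩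
  ∑[ z < m ] (𝟙 (x ≟ z) * F z y)
    ≡⟨ ∑-δ x (λ z → F z y) ⟩
  F x y ∎
  where open ≡-Reasoning

countFin-∑ : ∀ {n p} {P : Fin n → Set p} (P? : ∀ γ → Dec (P γ)) →
             countFin (λ γ → ⌊ P? γ ⌋) ≡ ∑[ γ < n ] 𝟙 (P? γ)
countFin-∑ {zero}  P? = refl
countFin-∑ {suc n} P? =
  cong₂ _+_ (cong (if_then 1 else 0) (isYes≗does (P? zero))) (countFin-∑ (P? ∘ suc))

countFin-⇔ : ∀ {n p q} {P : Fin n → Set p} {Q : Fin n → Set q}
             {P? : ∀ γ → Dec (P γ)} {Q? : ∀ γ → Dec (Q γ)} → (∀ γ → P γ ⇔ Q γ) →
             countFin (λ γ → ⌊ P? γ ⌋) ≡ countFin (λ γ → ⌊ Q? γ ⌋)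
countFin-⇔ {P? = P?} {Q?} P⇔Q = begin
  countFin (λ γ → ⌊ P? γ ⌋) ≡⟨ countFin-∑ P? ⟩
  sum (λ γ → 𝟙 (P? γ))
    ≡⟨ sum-cong-≗ (λ γ → cong (if_then 1 else 0) (does-⇔ (P⇔Q γ) (P? γ) (Q? γ))) ⟩
  sum (λ γ → 𝟙 (Q? γ))      ≡⟨ countFin-∑ Q? ⟨
  countFin (λ γ → ⌊ Q? γ ⌋) ∎
  where open ≡-Reasoning

countFin-positive : ∀ {n} (f : Fin n → Bool) γ → T (f γ) → 0 < countFin f
countFin-positive f zero t with f zero
... | true = s≤s z≤n
countFin-positive f (suc γ) t = <-≤-trans (countFin-positive (f ∘ suc) γ t) (m≤n+m _ _)

countFin-witness : ∀ {n} (f : Fin n → Bool) → 0 < countFin f → ∃ λ γ → T (f γ)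
countFin-witness {suc n} f pos with f zero in eq
... | true  = zero , subst T (sym eq) _
... | false = let γ , t = countFin-witness (f ∘ suc) pos in suc γ , t

countFin-none : ∀ {n} (f : Fin n → Bool) → (∀ γ → ¬ T (f γ)) → countFin f ≡ 0
countFin-none f none = n≤0⇒n≡0 (≮⇒≥ λ pos → let γ , t = countFin-witness f pos in none γ t)

∑-by-values : ∀ {n m} (f g : Fin n → Fin m) (F : Fin m → Fin m → ℕ) →
  ∑[ γ < n ] F (f γ) (g γ) ≡
  ∑[ z < m ] ∑[ z′ < m ] (countFin (λ γ → ⌊ (f γ ≟ z) ×-dec (g γ ≟ z′) ⌋) * F z z′)
∑-by-values {n} {m} f g F = begin
  ∑[ γ < n ] F (f γ) (g γ)
    ≡⟨ sum-cong-≗ (λ γ → sym (∑∑-δ (f γ) (g γ) F)) ⟩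
  ∑[ γ < n ] ∑[ z < m ] ∑[ z′ < m ] (δ γ z z′ * F z z′)
    ≡⟨ ∑-comm (λ γ z → ∑[ z′ < m ] (δ γ z z′ * F z z′)) ⟩
  ∑[ z < m ] ∑[ γ < n ] ∑[ z′ < m ] (δ γ z z′ * F z z′)
    ≡⟨ sum-cong-≗ (λ z → ∑-comm (λ γ z′ → δ γ z z′ * F z z′)) ⟩
  ∑[ z < m ] ∑[ z′ < m ] ∑[ γ < n ] (δ γ z z′ * F z z′)
    ≡⟨ sum-cong-≗ (λ z → sum-cong-≗ λ z′ → sym (*-distribʳ-sum (F z z′) (λ γ → δ γ z z′))) ⟩
  ∑[ z < m ] ∑[ z′ < m ] ((∑[ γ < n ] δ γ z z′) * F z z′)
    ≡⟨ sum-cong-≗ (λ z → sum-cong-≗ λ z′ →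
         cong (_* F z z′) (sym (countFin-∑ (λ γ → (f γ ≟ z) ×-dec (g γ ≟ z′))))) ⟩
  ∑[ z < m ] ∑[ z′ < m ] (countFin (λ γ → ⌊ (f γ ≟ z) ×-dec (g γ ≟ z′) ⌋) * F z z′) ∎
  where
  open ≡-Reasoning
  δ : Fin n → Fin m → Fin m → ℕ
  δ γ z z′ = 𝟙 ((f γ ≟ z) ×-dec (g γ ≟ z′))

-- Descent and quotients

descent : ∀ {p} {P : ℕ → Set p} (μ : ℕ → ℕ) → (∀ k → P k ⊎ μ (suc k) < μ k) → ∃ P
descent {P = P} μ step = go 0 (suc (μ 0)) ≤-refl
  where
  go : ∀ k fuel → μ k < fuel → ∃ P
  go k zero       ()
  go k (suc fuel) μk<1+fuel with step k
  ... | inj₁ Pk     = k , Pk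
  ... | inj₂ shrink = go (suc k) fuel (<-≤-trans shrink (≤-pred μk<1+fuel))

record Classification {N : ℕ} (E : Rel (Fin N) 0ℓ) : Set where
  field
    size             : ℕ
    class            : Fin N → Fin size
    class-surjective : ∀ c → ∃ λ x → class x ≡ c
    class-sound      : ∀ x y → class x ≡ class y → E x y
    class-complete   : ∀ x y → E x y → class x ≡ class y

module _ {N} {E : Rel (Fin (suc N)) 0ℓ} (E-isDecEq : IsDecEquivalence E)
         (C : Classification (E on suc)) where
  open IsDecEquivalence E-isDecEq using () renaming (refl to E-refl; sym to E-sym; trans to E-trans)
  open Classification C

  joinClassOf : ∀ y₀ → E zero (suc y₀) → Classification E
  joinClassOf y₀ 0~y₀ = record
    { size             = size
    ; class            = class′
    ; class-surjective = λ c → let x , cx≡c = class-surjective c in suc x , cx≡c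
    ; class-sound      = sound
    ; class-complete   = complete
    }
    where
    class′ : Fin (suc N) → Fin size
    class′ zero    = class y₀
    class′ (suc y) = class y

    sound : ∀ x y → class′ x ≡ class′ y → E x y
    sound zero    zero    _ = E-refl
    sound zero    (suc y) e = E-trans 0~y₀ (class-sound y₀ y e)
    sound (suc x) zero    e = E-sym (E-trans 0~y₀ (class-sound y₀ x (sym e)))
    sound (suc x) (suc y) e = class-sound x y e

    complete : ∀ x y → E x y → class′ x ≡ class′ y
    complete zero    zero    _ = refl
    complete zero    (suc y) e = class-complete y₀ y (E-trans (E-sym 0~y₀) e)
    complete (suc x) zero    e = sym (class-complete y₀ x (E-trans (E-sym 0~y₀) (E-sym e)))
    complete (suc x) (suc y) e = class-complete x y e

  newClass : (∀ y → ¬ E zero (suc y)) → Classification E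
  newClass 0≁ = record
    { size             = suc size
    ; class            = class′
    ; class-surjective = surjective
    ; class-sound      = sound
    ; class-complete   = complete
    }
    where
    class′ : Fin (suc N) → Fin (suc size)
    class′ zero    = zero
    class′ (suc y) = suc (class y)

    surjective : ∀ c → ∃ λ x → class′ x ≡ c
    surjective zero    = zero , refl
    surjective (suc c) = let x , cx≡c = class-surjective c in suc x , cong suc cx≡c

    sound : ∀ x y → class′ x ≡ class′ y → E x y
    sound zero    zero    _  = E-refl
    sound zero    (suc y) ()
    sound (suc x) zero    ()
    sound (suc x) (suc y) e  = class-sound x y (suc-injective e)

    complete : ∀ x y → E x y → class′ x ≡ class′ y
    complete zero    zero    _ = refl
    complete zero    (suc y) e = contradiction e (0≁ y)
    complete (suc x) zero    e = contradiction (E-sym e) (0≁ x)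
    complete (suc x) (suc y) e = cong suc (class-complete x y e)

classify : ∀ {N} {E : Rel (Fin N) 0ℓ} → IsDecEquivalence E → Classification E
classify {zero} _ = record
  { size = 0 ; class = λ () ; class-surjective = λ () ; class-sound = λ () ; class-complete = λ () }
classify {suc N} E-isDecEq with any? (λ y → E? zero (suc y)) | classify (On.isDecEquivalence suc E-isDecEq)
  where open IsDecEquivalence E-isDecEq using () renaming (_≟_ to E?)
... | yes (y₀ , 0~y₀) | C = joinClassOf E-isDecEq C y₀ 0~y₀
... | no ¬0~         | C = newClass E-isDecEq C (λ y 0~y → ¬0~ (y , 0~y))

-- Coherent configurations

∑-regular : ∀ {n} (Z : CC n) (F : Fin (m Z) → Fin (m Z) → ℕ) {a b c d} → col Z a b ≡ col Z c d →
            ∑[ γ < n ] F (col Z a γ) (col Z γ b) ≡ ∑[ γ < n ] F (col Z c γ) (col Z γ d)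
∑-regular {n} Z F {a} {b} {c} {d} e = begin
  ∑[ γ < n ] F (col Z a γ) (col Z γ b)
    ≡⟨ ∑-by-values (col Z a) (λ γ → col Z γ b) F ⟩
  ∑[ z < m Z ] ∑[ z′ < m Z ] (cnt (col Z) a b z z′ * F z z′)
    ≡⟨ sum-cong-≗ (λ z → sum-cong-≗ λ z′ → cong (_* F z z′) (regular Z z z′ a b c d e)) ⟩
  ∑[ z < m Z ] ∑[ z′ < m Z ] (cnt (col Z) c d z z′ * F z z′)
    ≡⟨ ∑-by-values (col Z c) (λ γ → col Z γ d) F ⟨
  ∑[ γ < n ] F (col Z c γ) (col Z γ d) ∎
  where open ≡-Reasoning

-- For the pair (α , b) the point γ = α has (α , γ) ∈ 1_{α}; regularity moves such a γ to (c , d).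
pointBasis-row : ∀ {n} (Z : CC n) {α} → PointBasis Z α →
                 ∀ {a b c d} → col Z a b ≡ col Z c d → a ≡ α → c ≡ α
pointBasis-row Z {α} pb {b = b} {c} {d} e refl =
  let γ , hit = countFin-witness (hits c d) positive in proj₁ (pb c γ (proj₁ (toWitness hit)))
  where
  hits : ∀ x y → Fin _ → Bool
  hits x y γ = ⌊ (col Z x γ ≟ col Z α α) ×-dec (col Z γ y ≟ col Z α b) ⌋
  positive : 0 < countFin (hits c d)
  positive = subst (0 <_) (regular Z _ _ α b c d e) (countFin-positive (hits α b) α (fromWitness (refl , refl)))

pointBasis-column : ∀ {n} (Z : CC n) {α} → PointBasis Z α →
                    ∀ {a b c d} → col Z a b ≡ col Z c d → b ≡ α → d ≡ α
pointBasis-column Z pb {a} {b} {c} {d} e = pointBasis-row Z pb (transp Z a b c d e)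

-- The colours inside 1_Ω, characterised by intersection numbers so that algebraic
-- isomorphisms preserve them.
DiagonalColour : ∀ {n} (X : CC n) → Fin (m X) → Set
DiagonalColour X t = ∀ u → u ≢ t → isect X t u t ≡ 0

diagonalColour-loop : ∀ {n} (X : CC n) α → DiagonalColour X (col X α α)
diagonalColour-loop {n} X α u u≢t =
  countFin-none (λ γ → ⌊ (col X a γ ≟ col X α α) ×-dec (col X γ b ≟ u) ⌋)
    λ γ hit → let aγ , γb = toWitness hit in u≢t (collapse γ aγ γb)
  where
  a b : Fin n
  a = proj₁ (surj X (col X α α))
  b = proj₁ (proj₂ (surj X (col X α α)))
  ab : col X a b ≡ col X α α
  ab = proj₂ (proj₂ (surj X (col X α α)))
  collapse : ∀ γ → col X a γ ≡ col X α α → col X γ b ≡ u → u ≡ col X α α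
  collapse γ aγ γb = trans (sym γb) (trans (cong (λ x → col X x b) (sym (diag X α a γ (sym aγ)))) ab)

diagonalColour-apply : ∀ {n n′} {X : CC n} {X′ : CC n′} (φ : AlgIso X X′) {t} →
                       DiagonalColour X t → DiagonalColour X′ (apply φ t)
diagonalColour-apply {X = X} {X′} φ {t} D u′ u′≢φt = begin
  isect X′ (apply φ t) u′ (apply φ t)          ≡⟨ cong (λ v → isect X′ (apply φ t) v (apply φ t)) φu≡u′ ⟨
  isect X′ (apply φ t) (apply φ u) (apply φ t) ≡⟨ preserve φ t u t ⟨
  isect X t u t                                ≡⟨ D u u≢t ⟩
  0 ∎
  where
  open ≡-Reasoning
  u : Fin (m X)
  u = Inverse.from (bij φ) u′
  φu≡u′ : apply φ u ≡ u′
  φu≡u′ = Inverse.strictlyInverseˡ (bij φ) u′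
  u≢t : u ≢ t
  u≢t u≡t = u′≢φt (trans (sym φu≡u′) (cong (apply φ) u≡t))

diagonalColour⇒loop : ∀ {n} (X : CC n) {t} → DiagonalColour X t → ∃ λ α → t ≡ col X α α
diagonalColour⇒loop {n} X {t} D = decide (a ≟ b)
  where
  a b : Fin n
  a = proj₁ (surj X t)
  b = proj₁ (proj₂ (surj X t))
  ab : col X a b ≡ t
  ab = proj₂ (proj₂ (surj X t))
  decide : Dec (a ≡ b) → ∃ λ α → t ≡ col X α α
  decide (yes a≡b) = a , trans (sym ab) (cong (col X a) (sym a≡b))
  decide (no a≢b)  = contradiction (D (col X b b) bb≢t) (n>0⇒n≢0 b-hits)
    where
    bb≢t : col X b b ≢ t
    bb≢t bb≡t = a≢b (diag X b a b (trans bb≡t (sym ab)))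
    b-hits : 0 < isect X t (col X b b) t
    b-hits = countFin-positive _ b (fromWitness (ab , refl))

-- Coherent closure and one-point extensions

module CoherentClosure {n} {C : Set} (_≟ᶜ_ : DecidableEquality C) (c₀ : Fin n → Fin n → C)
  (c₀-transpose : ∀ {a b c d} → c₀ a b ≡ c₀ c d → c₀ b a ≡ c₀ d c)
  (c₀-diagonal  : ∀ {a b c} → c₀ a a ≡ c₀ b c → b ≡ c) where

  Pair : Set
  Pair = Fin n × Fin n

  ∀-pair? : ∀ {p} {P : Pair → Set p} → (∀ x → Dec (P x)) → Dec (∀ x → P x)
  ∀-pair? P? = map′ (λ ∀ab x → ∀ab (proj₁ x) (proj₂ x)) (λ ∀x a b → ∀x (a , b))
                    (all? λ a → all? λ b → P? (a , b))

  ∃-pair? : ∀ {p} {P : Pair → Set p} → (∀ x → Dec (P x)) → Dec (∃ P)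
  ∃-pair? P? = map′ (λ (a , b , p) → (a , b) , p) (λ ((a , b) , p) → a , b , p)
                    (any? λ a → any? λ b → P? (a , b))

  ∑ᵖ : (Pair → ℕ) → ℕ
  ∑ᵖ f = ∑[ a < n ] ∑[ b < n ] f (a , b)

  ∑ᵖ-mono-≤ : ∀ {f g : Pair → ℕ} → (∀ x → f x ≤ g x) → ∑ᵖ f ≤ ∑ᵖ g
  ∑ᵖ-mono-≤ f≤g = ∑-mono-≤ λ a → ∑-mono-≤ λ b → f≤g (a , b)

  ∑ᵖ-mono-< : ∀ {f g : Pair → ℕ} → (∀ x → f x ≤ g x) → ∀ x → f x < g x → ∑ᵖ f < ∑ᵖ g
  ∑ᵖ-mono-< f≤g (a , b) fx<gx =
    ∑-mono-< (λ a′ → ∑-mono-≤ λ b′ → f≤g (a′ , b′)) a (∑-mono-< (λ b′ → f≤g (a , b′)) b fx<gx)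

  -- Same k x y: k rounds of Weisfeiler–Leman refinement of c₀ do not separate x and y.
  -- count k (a , b) u v counts the γ with (a , γ) in the class of u and (γ , b) in that of v.
  mutual
    Same : ℕ → Pair → Pair → Set
    Same zero    x y = uncurry c₀ x ≡ uncurry c₀ y
    Same (suc k) x y = Same k x y × (∀ u v → count k x u v ≡ count k y u v)

    same? : ∀ k x y → Dec (Same k x y)
    same? zero    x y = uncurry c₀ x ≟ᶜ uncurry c₀ y
    same? (suc k) x y = same? k x y ×-dec ∀-pair? λ u → ∀-pair? λ v → count k x u v ℕ.≟ count k y u v

    count : ℕ → Pair → Pair → Pair → ℕ
    count k (a , b) u v = countFin λ γ → ⌊ same? k (a , γ) u ×-dec same? k (γ , b) v ⌋

  same-refl : ∀ k {x} → Same k x x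
  same-refl zero    = refl
  same-refl (suc k) = same-refl k , λ _ _ → refl

  same-sym : ∀ k {x y} → Same k x y → Same k y x
  same-sym zero    = sym
  same-sym (suc k) (s , h) = same-sym k s , λ u v → sym (h u v)

  same-trans : ∀ k {x y z} → Same k x y → Same k y z → Same k x z
  same-trans zero    = trans
  same-trans (suc k) (s , h) (s′ , h′) = same-trans k s s′ , λ u v → trans (h u v) (h′ u v)

  same-isDecEquivalence : ∀ k → IsDecEquivalence (Same k)
  same-isDecEquivalence k = record
    { isEquivalence = record { refl = same-refl k ; sym = same-sym k ; trans = same-trans k }
    ; _≟_           = same? k
    }

  same⇒same₀ : ∀ k {x y} → Same k x y → Same zero x y
  same⇒same₀ zero    s       = s
  same⇒same₀ (suc k) (s , _) = same⇒same₀ k s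

  mutual
    same-swap : ∀ k {x y} → Same k x y → Same k (swap x) (swap y)
    same-swap zero    = c₀-transpose
    same-swap (suc k) {x} {y} (s , h) = same-swap k s , λ u v →
      trans (count-swap k (swap x) u v) (trans (h (swap v) (swap u)) (sym (count-swap k (swap y) u v)))

    count-swap : ∀ k x u v → count k x u v ≡ count k (swap x) (swap v) (swap u)
    count-swap k (a , b) u v = countFin-⇔ {n} λ γ → mk⇔ flip flip
      where
      flip : ∀ {x y x′ y′} → Same k x y × Same k x′ y′ →
             Same k (swap x′) (swap y′) × Same k (swap x) (swap y)
      flip (s , s′) = same-swap k s′ , same-swap k s

  Stable : ℕ → Set
  Stable k = ∀ x y → Same k x y → Same (suc k) x y

  related : ℕ → ℕ
  related k = ∑ᵖ λ x → ∑ᵖ λ y → 𝟙 (same? k x y)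

  stable-or-shrinks : ∀ k → Stable k ⊎ related (suc k) < related k
  stable-or-shrinks k with ∃-pair? (λ x → ∃-pair? λ y → same? k x y ×-dec ¬? (same? (suc k) x y))
  ... | yes (x , y , s , ¬s′) = inj₂
    (∑ᵖ-mono-< (λ x′ → ∑ᵖ-mono-≤ λ y′ → weaker x′ y′) x
      (∑ᵖ-mono-< (weaker x) y (𝟙-mono-< ¬s′ s (same? (suc k) x y) (same? k x y))))
    where
    weaker : ∀ x y → 𝟙 (same? (suc k) x y) ≤ 𝟙 (same? k x y)
    weaker x y = 𝟙-mono proj₁ (same? (suc k) x y) (same? k x y)
  ... | no none = inj₁ λ x y s → decidable-stable (same? (suc k) x y) λ ¬s′ → none (x , y , s , ¬s′)

  -- Opaque, so that the typechecker never runs the search for a stable round.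
  opaque
    stabilisation : ∃ Stable
    stabilisation = descent related stable-or-shrinks

  K : ℕ
  K = proj₁ stabilisation

  open Classification (classify (On.isDecEquivalence (remQuot n) (same-isDecEquivalence K)))

  colour : Fin n → Fin n → Fin size
  colour a b = class (combine a b)

  colour-sound : ∀ {a b c d} → colour a b ≡ colour c d → Same K (a , b) (c , d)
  colour-sound {a} {b} {c} {d} e =
    subst₂ (Same K) (remQuot-combine a b) (remQuot-combine c d) (class-sound _ _ e)

  colour-complete : ∀ {a b c d} → Same K (a , b) (c , d) → colour a b ≡ colour c d
  colour-complete {a} {b} {c} {d} s =
    class-complete _ _ (subst₂ (Same K) (sym (remQuot-combine a b)) (sym (remQuot-combine c d)) s)

  colour-surjective : ∀ r → ∃ λ x → uncurry colour x ≡ r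
  colour-surjective r = let x , e = class-surjective r in remQuot n x , trans (cong class (combine-remQuot {n} n x)) e

  cnt-colour : ∀ a b p q → cnt colour a b (uncurry colour p) (uncurry colour q) ≡ count K (a , b) p q
  cnt-colour a b p q = countFin-⇔ {n} λ γ →
    mk⇔ (λ (e , e′) → colour-sound e , colour-sound e′)
        (λ (s , s′) → colour-complete s , colour-complete s′)

  colour-regular : ∀ r s a b a′ b′ → colour a b ≡ colour a′ b′ →
                   cnt colour a b r s ≡ cnt colour a′ b′ r s
  colour-regular r s a b a′ b′ e with colour-surjective r | colour-surjective s
  ... | p , refl | q , refl = begin
    cnt colour a b (uncurry colour p) (uncurry colour q)   ≡⟨ cnt-colour a b p q ⟩
    count K (a , b) p q                                  ≡⟨ proj₂ (proj₂ stabilisation _ _ (colour-sound e)) p q ⟩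
    count K (a′ , b′) p q                                ≡⟨ cnt-colour a′ b′ p q ⟨
    cnt colour a′ b′ (uncurry colour p) (uncurry colour q) ∎
    where open ≡-Reasoning

  closure : CC n
  closure = record
    { m       = size
    ; col     = colour
    ; surj    = λ r → let (a , b) , e = colour-surjective r in a , b , e
    ; diag    = λ a b c e → c₀-diagonal (same⇒same₀ K (colour-sound e))
    ; transp  = λ a b c d e → colour-complete (same-swap K (colour-sound e))
    ; regular = colour-regular
    }

  closure-refines : ∀ a b c d → colour a b ≡ colour c d → c₀ a b ≡ c₀ c d
  closure-refines a b c d e = same⇒same₀ K (colour-sound e)

  module _ (Z : CC n) (Z-refines : ∀ a b c d → col Z a b ≡ col Z c d → c₀ a b ≡ c₀ c d) where

    InClass : ℕ → Pair → Fin (m Z) → Set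
    InClass k u z = ∃ λ w → uncurry (col Z) w ≡ z × Same k w u

    inClass? : ∀ k u z → Dec (InClass k u z)
    inClass? k u z = ∃-pair? λ w → (uncurry (col Z) w ≟ z) ×-dec same? k w u

    -- Inductively, every Same k-class is a union of Z-colours, so count k is an intersection
    -- number of unions of basis relations of Z, which is constant on Z-colours.
    same-colour⇒same : ∀ k {x y} → uncurry (col Z) x ≡ uncurry (col Z) y → Same k x y
    same-colour⇒same zero    e = Z-refines _ _ _ _ e
    same-colour⇒same (suc k) {a , b} {c , d} e = same-colour⇒same k e , λ u v → begin
      count k (a , b) u v                         ≡⟨ count-∑ a b u v ⟩
      ∑[ γ < n ] weight u v (col Z a γ) (col Z γ b) ≡⟨ ∑-regular Z (weight u v) e ⟩
      ∑[ γ < n ] weight u v (col Z c γ) (col Z γ d) ≡⟨ count-∑ c d u v ⟨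
      count k (c , d) u v ∎
      where
      open ≡-Reasoning
      same⇔inClass : ∀ {w} u → Same k w u ⇔ InClass k u (uncurry (col Z) w)
      same⇔inClass u =
        mk⇔ (λ s → _ , refl , s) λ (w′ , e′ , s) → same-trans k (same-colour⇒same k (sym e′)) s
      weight : Pair → Pair → Fin (m Z) → Fin (m Z) → ℕ
      weight u v z z′ = 𝟙 (inClass? k u z ×-dec inClass? k v z′)
      count-∑ : ∀ a b u v → count k (a , b) u v ≡ ∑[ γ < n ] weight u v (col Z a γ) (col Z γ b)
      count-∑ a b u v = trans (countFin-⇔ {n} λ γ → same⇔inClass u ×-⇔ same⇔inClass v)
        (countFin-∑ λ γ → inClass? k u (col Z a γ) ×-dec inClass? k v (col Z γ b))

    closure-least : Refines Z closure
    closure-least a b c d e = colour-complete (same-colour⇒same K e)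

module OnePointExtension {n} (X : CC n) (α : Fin n) where

  pointColour : Fin n → Fin n → Fin (m X) × Bool × Bool
  pointColour a b = col X a b , ⌊ a ≟ α ⌋ , ⌊ b ≟ α ⌋

  pointColour-transpose : ∀ {a b c d} → pointColour a b ≡ pointColour c d →
                          pointColour b a ≡ pointColour d c
  pointColour-transpose e = cong₂ _,_ (transp X _ _ _ _ (cong proj₁ e))
                                      (cong₂ _,_ (cong (proj₂ ∘ proj₂) e) (cong (proj₁ ∘ proj₂) e))

  pointColour-diagonal : ∀ {a b c} → pointColour a a ≡ pointColour b c → b ≡ c
  pointColour-diagonal e = diag X _ _ _ (cong proj₁ e)

  open CoherentClosure (≡-dec _≟_ (≡-dec Bool._≟_ Bool._≟_))
                       pointColour pointColour-transpose pointColour-diagonal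
    using (closure; closure-refines; closure-least)

  onePointExtension : CC n
  onePointExtension = closure

  onePointExtension-isOnePointExt : IsOnePointExt X α onePointExtension
  onePointExtension-isOnePointExt =
      (λ a b c d e → cong proj₁ (closure-refines a b c d e))
    , (λ β γ e → let e₀ = closure-refines β γ α α e in
                 is-α (cong (proj₁ ∘ proj₂) e₀) , is-α (cong (proj₂ ∘ proj₂) e₀))
    , λ Z Z-refines pb → closure-least Z λ a b c d e →
        cong₂ _,_ (Z-refines a b c d e) (cong₂ _,_
          (⌊⌋-⇔ (mk⇔ (pointBasis-row Z pb e) (pointBasis-row Z pb (sym e))) (a ≟ α) (c ≟ α))
          (⌊⌋-⇔ (mk⇔ (pointBasis-column Z pb e) (pointBasis-column Z pb (sym e))) (b ≟ α) (d ≟ α)))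
    where
    is-α : ∀ {β} → ⌊ β ≟ α ⌋ ≡ ⌊ α ≟ α ⌋ → β ≡ α
    is-α e = toWitness (subst T (sym e) (fromWitness refl))

open OnePointExtension public using (onePointExtension; onePointExtension-isOnePointExt)

sesquiseparable-of-empty : (X : CC 0) → Sesquiseparable X
sesquiseparable-of-empty X zero     X′ φ _ = ↔-refl , λ ()
sesquiseparable-of-empty X (suc n′) X′ φ _ =
  contradiction (proj₁ (surj X (Inverse.from (bij φ) (col X′ zero zero)))) ¬Fin0

sesquiseparable-from-point : ∀ {n} (X : CC n) (α : Fin n) →
  (∀ Y → IsOnePointExt X α Y → Separable Y) → Sesquiseparable X
sesquiseparable-from-point X α separable n′ X′ φ sesquiclosed
  with diagonalColour⇒loop X′ (diagonalColour-apply φ (diagonalColour-loop X α))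
... | α′ , φ[αα]≡α′α′
  with sesquiclosed α α′ φ[αα]≡α′α′ (onePointExtension X α) (onePointExtension-isOnePointExt X α)
                                    (onePointExtension X′ α′) (onePointExtension-isOnePointExt X′ α′)
... | ψ , ψ-over-φ , _
  with separable (onePointExtension X α) (onePointExtension-isOnePointExt X α)
                 n′ (onePointExtension X′ α′) ψ
... | f , f-over-ψ = f , λ a b → sym (ψ-over-φ a b (Inverse.to f a) (Inverse.to f b) (sym (f-over-ψ a b)))

lemma4p4 : ∀ (n : ℕ) (X : CC n) →
    (∀ (α : Fin n) (Y : CC n) → IsOnePointExt X α Y → Separable Y) →
    Sesquiseparable X
lemma4p4 zero    X _         = sesquiseparable-of-empty X
lemma4p4 (suc n) X separable = sesquiseparable-from-point X zero (separable zero)
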